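{- Let $G = KG(m,w)$ be a Kneser graph and let $G'$ be an induced subgraph of $G$. Then for every $n>0$, for all but at most $\frac{2^w(2w+2)}{n}|V(G')|^2$ edges $e$ of $G'$, there is a complete bipartite subgraph of $G'$ with at least $|V(G')|/n$ vertices on each side that contains $e$.
   Context: The Kneser graph $KG(m,w)$ has as vertices the $w$-element subsets of $\{1,\dots,m\}$, two vertices being adjacent iff the corresponding sets are disjoint.
   Formalization: The parameter n ranges over the positive rationals. -}

module Defs where

open import Data.Nat using (ℕ; _*_; _^_; _+_)
open import Data.Integer using (+_)
open import Data.Rational using (ℚ; _/_)
open import Data.Fin.Subset using (Subset; _∩_; Empty; ∣_∣)
open import Data.List using (List; length)
open import Data.List.Membership.Propositional using (_∈_)
open import Data.List.Relation.Unary.All using (All)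
open import Data.List.Relation.Unary.Unique.Propositional using (Unique)
open import Data.Product using (_×_)
open import Relation.Binary.PropositionalEquality using (_≡_; _≢_)

ℕtoℚ : ℕ → ℚ
ℕtoℚ k = (+ k) / 1

IsKneserVertex : (m w : ℕ) → Subset m → Set
IsKneserVertex m w A = ∣ A ∣ ≡ w

-- adjacency in KG(m,w): disjoint (and distinct, graphs have no loops)
Adj : {m : ℕ} → Subset m → Subset m → Set
Adj A B = Empty (A ∩ B) × A ≢ B

-- An induced subgraph G' of KG(m,w) is given by its vertex set:
-- a duplicate-free list of w-element subsets.
record InducedKneserSubgraph (m w : ℕ) : Set where
  field
    verts   : List (Subset m)
    unique  : Unique verts
    vertOK  : All (IsKneserVertex m w) verts

nV : {m w : ℕ} → InducedKneserSubgraph m w → ℕ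
nV G = length (InducedKneserSubgraph.verts G)

record Biclique {m w : ℕ} (G : InducedKneserSubgraph m w)
                (L R : List (Subset m)) : Set where
  field
    uniqueL : Unique L
    uniqueR : Unique R
    L⊆V     : All (_∈ InducedKneserSubgraph.verts G) L
    R⊆V     : All (_∈ InducedKneserSubgraph.verts G) R
    complete : All (λ a → All (λ b → Adj a b) R) L

-- Every U ⊆ {1..m} yields a complete bipartite subgraph of G' (for w > 0): the vertices L_U
-- contained in U against the vertices R_U disjoint from U.  A disjoint pair of w-sets is separated
-- in this way by exactly 2^(m-2w) sets U, and a fixed w-set lies inside (resp. outside) exactly
-- 2^(m-w) of them.  Call U balanced when both of its sides have at least |V(G')|/n vertices and
-- count the pairs (e , U) where U separates an edge e that no balanced set separates: there
-- are 2^(m-2w) of them per such edge, and at most |L_U| |R_U| ≤ (|V(G')|/n)(|L_U| + |R_U|) for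
-- each unbalanced U, in total at most 2 |V(G')|² 2^(m-w) / n.  So at most 2^(w+1) |V(G')|² / n
-- edges lie in no balanced biclique.
module Submission where

open import Defs
open import Data.Nat using (ℕ; _*_; _^_; _+_)
open import Data.Rational using (ℚ; 0ℚ) renaming (_*_ to _*ℚ_; _≤_ to _≤ℚ_; _<_ to _<ℚ_)
open import Data.Fin.Subset using (Subset)
open import Data.List using (List; length)
open import Data.List.Membership.Propositional using (_∈_; _∉_)
open import Data.Product using (_×_; _,_; Σ; ∃₂)

open import Data.Bool using (Bool; true; false; _∧_; not; T; T?)
open import Data.Bool.ListAction using (any)
open import Data.Bool.Properties using (T-∧; ∧-zeroʳ; ∧-identityʳ)
open import Data.Fin using (zero; suc)
open import Data.Fin.Subset using (inside; outside; ⊥; _∩_; _⊆_; _-_; Empty; ∣_∣)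
  renaming (_∈_ to _∈ₛ_)
open import Data.Fin.Subset.Properties
  using (Empty-unique; drop-∷-Empty; ∩-idem; ∣⊥∣≡0; x∈p∩q⁺; x∈p∩q⁻; x∈p⇒∣p-x∣<∣p∣; ∩-zeroˡ; ∩-zeroʳ; ∉⊥)
import Data.Integer as ℤ
import Data.Integer.Properties as ℤ
open import Data.List using ([]; _∷_; _++_; map; filterᵇ; cartesianProduct)
open import Data.List.Membership.Propositional using (find; lose)
open import Data.List.Membership.Propositional.Properties
  using (∈-filter⁺; ∈-filter⁻; ∈-cartesianProduct⁺; ∈-cartesianProduct⁻)
import Data.List.Relation.Unary.All as All
open import Data.List.Relation.Unary.Any using (here; there)
open import Data.List.Relation.Unary.Any.Properties using (any⁺; any⁻)
open import Data.List.Relation.Unary.Unique.Propositional.Properties using (filter⁺)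
open import Data.Nat using (zero; suc; _≤_; _<_; _≤ᵇ_; _≤?_; z≤n)
open import Data.Nat.Coprimality using (Coprime; 1-coprimeTo) renaming (sym to coprime-sym)
open import Data.Nat.Properties
open import Algebra.Properties.CommutativeSemigroup +-commutativeSemigroup using ()
  renaming (interchange to +-interchange)
open import Data.Nat.Tactic.RingSolver using (solve-∀)
open import Data.Product using (∃; proj₁; proj₂)
open import Data.Rational using (mkℚ; toℚᵘ; positive)
open import Data.Rational.Properties using (normalize-coprime; toℚᵘ-cancel-≤; toℚᵘ-homo-*)
open import Data.Rational.Unnormalised as ℚᵘ using (mkℚᵘ; _≃_; *≤*; *≡*)
import Data.Rational.Unnormalised.Properties as ℚᵘ
open import Data.Sum using (_⊎_; inj₁; inj₂)
open import Data.Vec using ([]; _∷_)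
import Data.Vec as Vec
open import Function using (_∘_; _⇔_; Equivalence; mk⇔)
open import Relation.Binary.PropositionalEquality
open import Relation.Nullary using (¬_; yes; no; contradiction)

𝟙 : Bool → ℕ
𝟙 true  = 1
𝟙 false = 0

𝟙-∧ : ∀ x y → 𝟙 (x ∧ y) ≡ 𝟙 x * 𝟙 y
𝟙-∧ true  y = sym (+-identityʳ (𝟙 y))
𝟙-∧ false y = refl

T-not : ∀ {x} → T (not x) ⇔ (¬ T x)
T-not {true}  = mk⇔ (λ ()) (λ ¬x → ¬x _)
T-not {false} = mk⇔ (λ _ ()) _

∑ : {A : Set} → List A → (A → ℕ) → ℕ
∑ []       f = 0
∑ (x ∷ xs) f = f x + ∑ xs f

infixl 10 ∑
syntax ∑ xs (λ x → e) = ∑[ x ∈ xs ] e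

count : {A : Set} → (A → Bool) → List A → ℕ
count p xs = ∑[ x ∈ xs ] 𝟙 (p x)

module _ {A : Set} where

  ∑-cong : ∀ (xs : List A) {f g : A → ℕ} → (∀ {x} → x ∈ xs → f x ≡ g x) → ∑ xs f ≡ ∑ xs g
  ∑-cong []       f≗g = refl
  ∑-cong (x ∷ xs) f≗g = cong₂ _+_ (f≗g (here refl)) (∑-cong xs (f≗g ∘ there))

  ∑-mono : ∀ (xs : List A) {f g : A → ℕ} → (∀ {x} → x ∈ xs → f x ≤ g x) → ∑ xs f ≤ ∑ xs g
  ∑-mono []       f≤g = z≤n
  ∑-mono (x ∷ xs) f≤g = +-mono-≤ (f≤g (here refl)) (∑-mono xs (f≤g ∘ there))

  ∑-+ : ∀ (xs : List A) (f g : A → ℕ) → ∑[ x ∈ xs ] (f x + g x) ≡ ∑ xs f + ∑ xs g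
  ∑-+ []       f g = refl
  ∑-+ (x ∷ xs) f g rewrite ∑-+ xs f g = +-interchange (f x) (g x) (∑ xs f) (∑ xs g)

  ∑-*ˡ : ∀ (xs : List A) c (f : A → ℕ) → ∑[ x ∈ xs ] (c * f x) ≡ c * ∑ xs f
  ∑-*ˡ []       c f = sym (*-zeroʳ c)
  ∑-*ˡ (x ∷ xs) c f rewrite ∑-*ˡ xs c f = sym (*-distribˡ-+ c (f x) (∑ xs f))

  ∑-*ʳ : ∀ (xs : List A) c (f : A → ℕ) → ∑[ x ∈ xs ] (f x * c) ≡ ∑ xs f * c
  ∑-*ʳ xs c f = begin
    ∑[ x ∈ xs ] (f x * c)  ≡⟨ ∑-cong xs (λ {x} _ → *-comm (f x) c) ⟩
    ∑[ x ∈ xs ] (c * f x)  ≡⟨ ∑-*ˡ xs c f ⟩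
    c * ∑ xs f             ≡⟨ *-comm c _ ⟩
    ∑ xs f * c             ∎
    where open ≡-Reasoning

  ∑-const : ∀ (xs : List A) c → ∑[ x ∈ xs ] c ≡ length xs * c
  ∑-const []       c = refl
  ∑-const (x ∷ xs) c = cong (c +_) (∑-const xs c)

  ∑-++ : ∀ (xs ys : List A) (f : A → ℕ) → ∑ (xs ++ ys) f ≡ ∑ xs f + ∑ ys f
  ∑-++ []       ys f = refl
  ∑-++ (x ∷ xs) ys f rewrite ∑-++ xs ys f = sym (+-assoc (f x) (∑ xs f) (∑ ys f))

  ∑-map : {B : Set} (h : B → A) (ys : List B) (f : A → ℕ) → ∑ (map h ys) f ≡ ∑ ys (f ∘ h)
  ∑-map h []       f = refl
  ∑-map h (y ∷ ys) f = cong (f (h y) +_) (∑-map h ys f)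

  length-filterᵇ : ∀ (p : A → Bool) xs → length (filterᵇ p xs) ≡ count p xs
  length-filterᵇ p []       = refl
  length-filterᵇ p (x ∷ xs) with p x
  ... | true  = cong suc (length-filterᵇ p xs)
  ... | false = length-filterᵇ p xs

  count-filterᵇ-≤ : ∀ (p q : A → Bool) xs → count q (filterᵇ p xs) ≤ count q xs
  count-filterᵇ-≤ p q []       = z≤n
  count-filterᵇ-≤ p q (x ∷ xs) with p x
  ... | true  = +-monoʳ-≤ (𝟙 (q x)) (count-filterᵇ-≤ p q xs)
  ... | false = m≤n⇒m≤o+n (𝟙 (q x)) (count-filterᵇ-≤ p q xs)

  count-none : ∀ (p : A → Bool) xs → (∀ {x} → x ∈ xs → ¬ T (p x)) → count p xs ≡ 0
  count-none p []       _   = refl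
  count-none p (x ∷ xs) ¬p with p x | ¬p (here refl)
  ... | true  | ¬px = contradiction _ ¬px
  ... | false | _   = count-none p xs (¬p ∘ there)

∑-swap : {A B : Set} (xs : List A) (ys : List B) (f : A → B → ℕ) →
         ∑[ x ∈ xs ] ∑[ y ∈ ys ] f x y ≡ ∑[ y ∈ ys ] ∑[ x ∈ xs ] f x y
∑-swap []       ys f = sym (trans (∑-const ys 0) (*-zeroʳ (length ys)))
∑-swap (x ∷ xs) ys f rewrite ∑-swap xs ys f = sym (∑-+ ys (f x) (λ y → ∑[ x ∈ xs ] f x y))

count-cartesianProduct : ∀ {A B : Set} (f : A → Bool) (g : B → Bool) (xs : List A) (ys : List B) →
  count (λ e → f (proj₁ e) ∧ g (proj₂ e)) (cartesianProduct xs ys) ≡ count f xs * count g ys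
count-cartesianProduct f g []       ys = refl
count-cartesianProduct {A} {B} f g (x ∷ xs) ys = begin
  count fg (map (x ,_) ys ++ cartesianProduct xs ys)
    ≡⟨ ∑-++ (map (x ,_) ys) _ (𝟙 ∘ fg) ⟩
  count fg (map (x ,_) ys) + count fg (cartesianProduct xs ys)
    ≡⟨ cong₂ _+_ (∑-map (x ,_) ys (𝟙 ∘ fg)) (count-cartesianProduct f g xs ys) ⟩
  ∑[ y ∈ ys ] 𝟙 (f x ∧ g y) + count f xs * count g ys
    ≡⟨ cong (_+ _) (trans (∑-cong ys (λ {y} _ → 𝟙-∧ (f x) (g y))) (∑-*ˡ ys (𝟙 (f x)) (𝟙 ∘ g))) ⟩
  𝟙 (f x) * count g ys + count f xs * count g ys
    ≡⟨ sym (*-distribʳ-+ (count g ys) (𝟙 (f x)) (count f xs)) ⟩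
  count f (x ∷ xs) * count g ys ∎
  where
  open ≡-Reasoning
  fg : A × B → Bool
  fg e = f (proj₁ e) ∧ g (proj₂ e)

unbalanced-product-bound : ∀ {a b k p} → a * p < k ⊎ b * p < k → p * (a * b) ≤ k * (a + b)
unbalanced-product-bound {a} {b} {k} {p} (inj₁ ap<k) = begin
  p * (a * b)  ≡⟨ p*[a*b]≡a*p*b p a b ⟩
  a * p * b    ≤⟨ *-monoˡ-≤ b (<⇒≤ ap<k) ⟩
  k * b        ≤⟨ *-monoʳ-≤ k (m≤n+m b a) ⟩
  k * (a + b)  ∎
  where
  open ≤-Reasoning
  p*[a*b]≡a*p*b : ∀ p a b → p * (a * b) ≡ a * p * b
  p*[a*b]≡a*p*b = solve-∀
unbalanced-product-bound {a} {b} {k} {p} (inj₂ bp<k) = begin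
  p * (a * b)  ≡⟨ p*[a*b]≡b*p*a p a b ⟩
  b * p * a    ≤⟨ *-monoˡ-≤ a (<⇒≤ bp<k) ⟩
  k * a        ≤⟨ *-monoʳ-≤ k (m≤m+n a b) ⟩
  k * (a + b)  ∎
  where
  open ≤-Reasoning
  p*[a*b]≡b*p*a : ∀ p a b → p * (a * b) ≡ b * p * a
  p*[a*b]≡b*p*a = solve-∀

_⊆ᵇ_ : ∀ {m} → Subset m → Subset m → Bool
[]            ⊆ᵇ []      = true
(inside  ∷ C) ⊆ᵇ (u ∷ U) = u ∧ C ⊆ᵇ U
(outside ∷ C) ⊆ᵇ (_ ∷ U) = C ⊆ᵇ U

disjointᵇ : ∀ {m} → Subset m → Subset m → Bool
disjointᵇ []            []      = true
disjointᵇ (inside  ∷ D) (u ∷ U) = not u ∧ disjointᵇ D U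
disjointᵇ (outside ∷ D) (_ ∷ U) = disjointᵇ D U

⊆ᵇ⇒⊆ : ∀ {m} {C U : Subset m} → T (C ⊆ᵇ U) → C ⊆ U
⊆ᵇ⇒⊆ {C = inside  ∷ C} {inside ∷ U} C⊆U Vec.here        = Vec.here
⊆ᵇ⇒⊆ {C = inside  ∷ C} {inside ∷ U} C⊆U (Vec.there x∈C) = Vec.there (⊆ᵇ⇒⊆ C⊆U x∈C)
⊆ᵇ⇒⊆ {C = outside ∷ C} {_      ∷ U} C⊆U (Vec.there x∈C) = Vec.there (⊆ᵇ⇒⊆ C⊆U x∈C)

disjointᵇ⇒Empty : ∀ {m} {D U : Subset m} → T (disjointᵇ D U) → Empty (D ∩ U)
disjointᵇ⇒Empty {D = inside  ∷ D} {outside ∷ U} D#U (suc x , Vec.there x∈) = disjointᵇ⇒Empty D#U (x , x∈)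
disjointᵇ⇒Empty {D = outside ∷ D} {_       ∷ U} D#U (suc x , Vec.there x∈) = disjointᵇ⇒Empty D#U (x , x∈)

Empty⇒disjointᵇ : ∀ {m} {D U : Subset m} → Empty (D ∩ U) → T (disjointᵇ D U)
Empty⇒disjointᵇ {D = []}          {[]}          _   = _
Empty⇒disjointᵇ {D = inside  ∷ D} {inside  ∷ U} D#U = D#U (zero , Vec.here)
Empty⇒disjointᵇ {D = inside  ∷ D} {outside ∷ U} D#U = Empty⇒disjointᵇ (drop-∷-Empty D#U)
Empty⇒disjointᵇ {D = outside ∷ D} {_       ∷ U} D#U = Empty⇒disjointᵇ (drop-∷-Empty D#U)

⊥⊆ᵇ : ∀ {m} (U : Subset m) → ⊥ ⊆ᵇ U ≡ true
⊥⊆ᵇ []      = refl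
⊥⊆ᵇ (_ ∷ U) = ⊥⊆ᵇ U

disjointᵇ-⊥ : ∀ {m} (U : Subset m) → disjointᵇ ⊥ U ≡ true
disjointᵇ-⊥ []      = refl
disjointᵇ-⊥ (_ ∷ U) = disjointᵇ-⊥ U

Empty-∩⊥ : ∀ {m} (C : Subset m) → Empty (C ∩ ⊥)
Empty-∩⊥ C (x , x∈C∩⊥) = ∉⊥ (subst (x ∈ₛ_) (∩-zeroʳ C) x∈C∩⊥)

Empty-⊥∩ : ∀ {m} (D : Subset m) → Empty (⊥ ∩ D)
Empty-⊥∩ D (x , x∈⊥∩D) = ∉⊥ (subst (x ∈ₛ_) (∩-zeroˡ D) x∈⊥∩D)

∣p∣≡0⇒p≡⊥ : ∀ {m} {p : Subset m} → ∣ p ∣ ≡ 0 → p ≡ ⊥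
∣p∣≡0⇒p≡⊥ {p = p} ∣p∣≡0 = Empty-unique λ (x , x∈p) → n≮0 (subst (∣ p - x ∣ <_) ∣p∣≡0 (x∈p⇒∣p-x∣<∣p∣ x∈p))

⊆-Empty⇒Empty : ∀ {m} {a b U : Subset m} → a ⊆ U → Empty (b ∩ U) → Empty (a ∩ b)
⊆-Empty⇒Empty a⊆U b#U (x , x∈a∩b) =
  let x∈a , x∈b = x∈p∩q⁻ _ _ x∈a∩b in b#U (x , x∈p∩q⁺ (x∈b , a⊆U x∈a))

allSubsets : ∀ m → List (Subset m)
allSubsets zero    = [] ∷ []
allSubsets (suc m) = map (inside ∷_) (allSubsets m) ++ map (outside ∷_) (allSubsets m)

count-allSubsets : ∀ {m} (p : Subset (suc m) → Bool) → count p (allSubsets (suc m)) ≡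
  count (p ∘ (inside ∷_)) (allSubsets m) + count (p ∘ (outside ∷_)) (allSubsets m)
count-allSubsets {m} p = trans (∑-++ (map (inside ∷_) (allSubsets m)) _ (𝟙 ∘ p))
  (cong₂ _+_ (∑-map (inside ∷_) (allSubsets m) (𝟙 ∘ p)) (∑-map (outside ∷_) (allSubsets m) (𝟙 ∘ p)))

separatesᵇ : ∀ {m} → Subset m → Subset m × Subset m → Bool
separatesᵇ U e = proj₁ e ⊆ᵇ U ∧ disjointᵇ (proj₂ e) U

separators : ∀ {m} → Subset m → Subset m → ℕ
separators {m} C D = count (λ U → separatesᵇ U (C , D)) (allSubsets m)

-- In each coordinate, a separator of disjoint sets has one forced choice for every element of
-- C ∪ D and two free choices elsewhere.
separators-count : ∀ {m} (C D : Subset m) → Empty (C ∩ D) →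
                   separators C D * 2 ^ (∣ C ∣ + ∣ D ∣) ≡ 2 ^ m
separators-count []            []            _   = refl
separators-count (inside  ∷ C) (inside  ∷ D) C#D = contradiction (zero , Vec.here) C#D
separators-count {suc m} (inside ∷ C) (outside ∷ D) C#D = begin
  separators (inside ∷ C) (outside ∷ D) * 2 ^ suc (∣ C ∣ + ∣ D ∣)
    ≡⟨ cong (_* 2 ^ suc (∣ C ∣ + ∣ D ∣)) (trans (count-allSubsets (λ U → separatesᵇ U (inside ∷ C , outside ∷ D)))
                                              (cong (separators C D +_) (count-none _ (allSubsets m) λ _ ()))) ⟩
  (separators C D + 0) * (2 * 2 ^ (∣ C ∣ + ∣ D ∣))
    ≡⟨ [n+0]*[2*t]≡2*[n*t] (separators C D) _ ⟩
  2 * (separators C D * 2 ^ (∣ C ∣ + ∣ D ∣))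
    ≡⟨ cong (2 *_) (separators-count C D (drop-∷-Empty C#D)) ⟩
  2 ^ suc m ∎
  where
  open ≡-Reasoning
  [n+0]*[2*t]≡2*[n*t] : ∀ n t → (n + 0) * (2 * t) ≡ 2 * (n * t)
  [n+0]*[2*t]≡2*[n*t] = solve-∀
separators-count {suc m} (outside ∷ C) (inside ∷ D) C#D = begin
  separators (outside ∷ C) (inside ∷ D) * 2 ^ (∣ C ∣ + suc ∣ D ∣)
    ≡⟨ cong₂ _*_ (trans (count-allSubsets (λ U → separatesᵇ U (outside ∷ C , inside ∷ D)))
                        (cong (_+ separators C D) (count-none _ (allSubsets m) (λ {U} _ → subst T (∧-zeroʳ (C ⊆ᵇ U))))))
                 (cong (2 ^_) (+-suc ∣ C ∣ ∣ D ∣)) ⟩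
  (0 + separators C D) * (2 * 2 ^ (∣ C ∣ + ∣ D ∣))
    ≡⟨ [0+n]*[2*t]≡2*[n*t] (separators C D) _ ⟩
  2 * (separators C D * 2 ^ (∣ C ∣ + ∣ D ∣))
    ≡⟨ cong (2 *_) (separators-count C D (drop-∷-Empty C#D)) ⟩
  2 ^ suc m ∎
  where
  open ≡-Reasoning
  [0+n]*[2*t]≡2*[n*t] : ∀ n t → (0 + n) * (2 * t) ≡ 2 * (n * t)
  [0+n]*[2*t]≡2*[n*t] = solve-∀
separators-count {suc m} (outside ∷ C) (outside ∷ D) C#D = begin
  separators (outside ∷ C) (outside ∷ D) * 2 ^ (∣ C ∣ + ∣ D ∣)
    ≡⟨ cong (_* 2 ^ (∣ C ∣ + ∣ D ∣)) (count-allSubsets (λ U → separatesᵇ U (outside ∷ C , outside ∷ D))) ⟩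
  (separators C D + separators C D) * 2 ^ (∣ C ∣ + ∣ D ∣)
    ≡⟨ [n+n]*t≡2*[n*t] (separators C D) _ ⟩
  2 * (separators C D * 2 ^ (∣ C ∣ + ∣ D ∣))
    ≡⟨ cong (2 *_) (separators-count C D (drop-∷-Empty C#D)) ⟩
  2 ^ suc m ∎
  where
  open ≡-Reasoning
  [n+n]*t≡2*[n*t] : ∀ n t → (n + n) * t ≡ 2 * (n * t)
  [n+n]*t≡2*[n*t] = solve-∀

supersets-count : ∀ {m} (C : Subset m) → count (C ⊆ᵇ_) (allSubsets m) * 2 ^ ∣ C ∣ ≡ 2 ^ m
supersets-count {m} C = begin
  count (C ⊆ᵇ_) (allSubsets m) * 2 ^ ∣ C ∣
    ≡⟨ cong₂ _*_ (∑-cong (allSubsets m) λ {U} _ →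
                   cong 𝟙 (sym (trans (cong (C ⊆ᵇ U ∧_) (disjointᵇ-⊥ U)) (∧-identityʳ (C ⊆ᵇ U)))))
                 (cong (2 ^_) (sym (trans (cong (∣ C ∣ +_) (∣⊥∣≡0 m)) (+-identityʳ _)))) ⟩
  separators C ⊥ * 2 ^ (∣ C ∣ + ∣ ⊥ {m} ∣)
    ≡⟨ separators-count C ⊥ (Empty-∩⊥ C) ⟩
  2 ^ m ∎
  where open ≡-Reasoning

disjoint-count : ∀ {m} (D : Subset m) → count (disjointᵇ D) (allSubsets m) * 2 ^ ∣ D ∣ ≡ 2 ^ m
disjoint-count {m} D = begin
  count (disjointᵇ D) (allSubsets m) * 2 ^ ∣ D ∣
    ≡⟨ cong₂ _*_ (∑-cong (allSubsets m) λ {U} _ → cong (λ b → 𝟙 (b ∧ disjointᵇ D U)) (sym (⊥⊆ᵇ U)))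
                 (cong (2 ^_) (sym (cong (_+ ∣ D ∣) (∣⊥∣≡0 m)))) ⟩
  separators ⊥ D * 2 ^ (∣ ⊥ {m} ∣ + ∣ D ∣)
    ≡⟨ separators-count ⊥ D (Empty-⊥∩ D) ⟩
  2 ^ m ∎
  where open ≡-Reasoning

module _ {m w : ℕ} (G : InducedKneserSubgraph m w) where
  open InducedKneserSubgraph G

  lower upper : Subset m → List (Subset m)
  lower U = filterᵇ (_⊆ᵇ U) verts
  upper U = filterᵇ (λ D → disjointᵇ D U) verts

  ∣vertex∣≡w : ∀ {A} → A ∈ verts → ∣ A ∣ ≡ w
  ∣vertex∣≡w = All.lookup vertOK

  adjacent⇒w≢0 : ∀ {A B} → A ∈ verts → B ∈ verts → Adj A B → w ≢ 0
  adjacent⇒w≢0 A∈V B∈V (_ , A≢B) w≡0 =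
    A≢B (trans (∣p∣≡0⇒p≡⊥ (trans (∣vertex∣≡w A∈V) w≡0)) (sym (∣p∣≡0⇒p≡⊥ (trans (∣vertex∣≡w B∈V) w≡0))))

  lower-upper-biclique : w ≢ 0 → ∀ U → Biclique G (lower U) (upper U)
  lower-upper-biclique w≢0 U = record
    { uniqueL  = filter⁺ (T? ∘ (_⊆ᵇ U)) unique
    ; uniqueR  = filter⁺ (T? ∘ (λ D → disjointᵇ D U)) unique
    ; L⊆V      = All.tabulate (proj₁ ∘ ∈-filter⁻ (T? ∘ (_⊆ᵇ U)))
    ; R⊆V      = All.tabulate (proj₁ ∘ ∈-filter⁻ (T? ∘ (λ D → disjointᵇ D U)))
    ; complete = All.tabulate λ a∈L → All.tabulate λ b∈R → adjacent a∈L b∈R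
    }
    where
    adjacent : ∀ {a b} → a ∈ lower U → b ∈ upper U → Adj a b
    adjacent {a} {b} a∈L b∈R = a#b , a≢b
      where
      a∈V : a ∈ verts
      a∈V = proj₁ (∈-filter⁻ (T? ∘ (_⊆ᵇ U)) {xs = verts} a∈L)
      a#b : Empty (a ∩ b)
      a#b = ⊆-Empty⇒Empty (⊆ᵇ⇒⊆ (proj₂ (∈-filter⁻ (T? ∘ (_⊆ᵇ U)) {xs = verts} a∈L)))
                          (disjointᵇ⇒Empty (proj₂ (∈-filter⁻ (T? ∘ (λ D → disjointᵇ D U)) {xs = verts} b∈R)))
      a≢b : a ≢ b
      a≢b refl = w≢0 (begin
        w          ≡⟨ sym (∣vertex∣≡w a∈V) ⟩
        ∣ a ∣      ≡⟨ cong ∣_∣ (Empty-unique (subst Empty (∩-idem a) a#b)) ⟩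
        ∣ ⊥ {m} ∣  ≡⟨ ∣⊥∣≡0 m ⟩
        0          ∎)
        where open ≡-Reasoning

  ∑-length-filterᵇ-regular : (r : Subset m → Subset m → Bool) →
    (∀ C → count (r C) (allSubsets m) * 2 ^ ∣ C ∣ ≡ 2 ^ m) →
    ∑[ U ∈ allSubsets m ] length (filterᵇ (λ C → r C U) verts) * 2 ^ w ≡ nV G * 2 ^ m
  ∑-length-filterᵇ-regular r regular = begin
    ∑[ U ∈ allSubsets m ] length (filterᵇ (λ C → r C U) verts) * 2 ^ w
      ≡⟨ cong (_* 2 ^ w) (∑-cong (allSubsets m) λ {U} _ → length-filterᵇ (λ C → r C U) verts) ⟩
    ∑[ U ∈ allSubsets m ] ∑[ C ∈ verts ] 𝟙 (r C U) * 2 ^ w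
      ≡⟨ cong (_* 2 ^ w) (∑-swap (allSubsets m) verts (λ U C → 𝟙 (r C U))) ⟩
    ∑[ C ∈ verts ] count (r C) (allSubsets m) * 2 ^ w
      ≡⟨ sym (∑-*ʳ verts (2 ^ w) (λ C → count (r C) (allSubsets m))) ⟩
    ∑[ C ∈ verts ] (count (r C) (allSubsets m) * 2 ^ w)
      ≡⟨ ∑-cong verts (λ {C} C∈V →
           subst (λ n → count (r C) (allSubsets m) * 2 ^ n ≡ 2 ^ m) (∣vertex∣≡w C∈V) (regular C)) ⟩
    ∑[ C ∈ verts ] (2 ^ m)
      ≡⟨ ∑-const verts (2 ^ m) ⟩
    nV G * 2 ^ m ∎
    where open ≡-Reasoning

  -- For n = p/q and k = |V(G')| q, a set U is balanced iff both of its sides have at least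
  -- |V(G')|/n vertices.
  module _ (k p : ℕ) where

    balanced : Subset m → Bool
    balanced U = (k ≤ᵇ length (lower U) * p) ∧ (k ≤ᵇ length (upper U) * p)

    covered : Subset m × Subset m → Bool
    covered e = any (λ U → separatesᵇ U e ∧ balanced U) (allSubsets m)

    uncovered : List (Subset m × Subset m)
    uncovered = filterᵇ (λ e → disjointᵇ (proj₁ e) (proj₂ e) ∧ not (covered e)) (cartesianProduct verts verts)

    covered-edge : ∀ {A B} → A ∈ verts → B ∈ verts → Empty (A ∩ B) → (A , B) ∉ uncovered →
      ∃ λ U → A ∈ lower U × B ∈ upper U × k ≤ length (lower U) * p × k ≤ length (upper U) * p
    covered-edge {A} {B} A∈V B∈V A#B AB∉uncovered with T? (covered (A , B))
    ... | no ¬cov = contradiction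
      (∈-filter⁺ (T? ∘ _) (∈-cartesianProduct⁺ A∈V B∈V)
                 (Equivalence.from T-∧ (Empty⇒disjointᵇ A#B , Equivalence.from T-not ¬cov)))
      AB∉uncovered
    ... | yes cov =
      let U , _ , sep∧bal = find (any⁻ _ (allSubsets m) cov)
          sep , bal       = Equivalence.to T-∧ sep∧bal
          A⊆U , B#U       = Equivalence.to T-∧ sep
          k≤L , k≤R       = Equivalence.to T-∧ bal
      in U , ∈-filter⁺ (T? ∘ (_⊆ᵇ U)) A∈V A⊆U , ∈-filter⁺ (T? ∘ (λ D → disjointᵇ D U)) B∈V B#U ,
         ≤ᵇ⇒≤ k _ k≤L , ≤ᵇ⇒≤ k _ k≤R

    edge-in-balanced-biclique : ∀ {A B} → A ∈ verts → B ∈ verts → Adj A B → (A , B) ∉ uncovered →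
      ∃₂ λ L R → Biclique G L R × A ∈ L × B ∈ R × k ≤ length L * p × k ≤ length R * p
    edge-in-balanced-biclique A∈V B∈V A~B AB∉uncovered =
      let U , A∈L , B∈R , k≤L , k≤R = covered-edge A∈V B∈V (proj₁ A~B) AB∉uncovered
      in lower U , upper U , lower-upper-biclique (adjacent⇒w≢0 A∈V B∈V A~B) U , A∈L , B∈R , k≤L , k≤R

    ¬balanced : ∀ {U} → ¬ T (balanced U) → length (lower U) * p < k ⊎ length (upper U) * p < k
    ¬balanced {U} ¬bal with k ≤? length (lower U) * p | k ≤? length (upper U) * p
    ... | yes kL  | yes kR  = contradiction (Equivalence.from T-∧ (≤⇒≤ᵇ kL , ≤⇒≤ᵇ kR)) ¬bal
    ... | no  k≰L | _       = inj₁ (≰⇒> k≰L)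
    ... | yes _   | no  k≰R = inj₂ (≰⇒> k≰R)

    separated-uncovered-bound : ∀ {U} → U ∈ allSubsets m →
      p * count (separatesᵇ U) uncovered ≤ k * (length (lower U) + length (upper U))
    separated-uncovered-bound {U} U∈S with T? (balanced U)
    ... | yes bal = begin
      p * count (separatesᵇ U) uncovered  ≡⟨ cong (p *_) (count-none (separatesᵇ U) uncovered ¬separated) ⟩
      p * 0                               ≡⟨ *-zeroʳ p ⟩
      0                                   ≤⟨ z≤n ⟩
      k * (length (lower U) + length (upper U)) ∎
      where
      open ≤-Reasoning
      ¬separated : ∀ {e} → e ∈ uncovered → ¬ T (separatesᵇ U e)
      ¬separated e∈unc sep = Equivalence.to T-not
        (proj₂ (Equivalence.to T-∧ (proj₂ (∈-filter⁻ (T? ∘ _) {xs = cartesianProduct verts verts} e∈unc))))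
        (any⁺ _ (lose U∈S (Equivalence.from T-∧ (sep , bal))))
    ... | no ¬bal = begin
      p * count (separatesᵇ U) uncovered
        ≤⟨ *-monoʳ-≤ p (count-filterᵇ-≤ _ (separatesᵇ U) (cartesianProduct verts verts)) ⟩
      p * count (separatesᵇ U) (cartesianProduct verts verts)
        ≡⟨ cong (p *_) (count-cartesianProduct (_⊆ᵇ U) (λ D → disjointᵇ D U) verts verts) ⟩
      p * (count (_⊆ᵇ U) verts * count (λ D → disjointᵇ D U) verts)
        ≡⟨ sym (cong₂ (λ a b → p * (a * b)) (length-filterᵇ _ verts) (length-filterᵇ _ verts)) ⟩
      p * (length (lower U) * length (upper U))
        ≤⟨ unbalanced-product-bound {length (lower U)} {length (upper U)} (¬balanced ¬bal) ⟩
      k * (length (lower U) + length (upper U)) ∎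
      where open ≤-Reasoning

    uncovered-separations :
      ∑[ U ∈ allSubsets m ] count (separatesᵇ U) uncovered * (2 ^ w * 2 ^ w) ≡ length uncovered * 2 ^ m
    uncovered-separations = begin
      ∑[ U ∈ allSubsets m ] count (separatesᵇ U) uncovered * (2 ^ w * 2 ^ w)
        ≡⟨ cong (_* (2 ^ w * 2 ^ w)) (sym (∑-swap uncovered (allSubsets m) (λ e U → 𝟙 (separatesᵇ U e)))) ⟩
      ∑[ e ∈ uncovered ] separators (proj₁ e) (proj₂ e) * (2 ^ w * 2 ^ w)
        ≡⟨ sym (∑-*ʳ uncovered (2 ^ w * 2 ^ w) (λ e → separators (proj₁ e) (proj₂ e))) ⟩
      ∑[ e ∈ uncovered ] (separators (proj₁ e) (proj₂ e) * (2 ^ w * 2 ^ w))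
        ≡⟨ ∑-cong uncovered separations ⟩
      ∑[ e ∈ uncovered ] (2 ^ m)
        ≡⟨ ∑-const uncovered (2 ^ m) ⟩
      length uncovered * 2 ^ m ∎
      where
      open ≡-Reasoning
      separations : ∀ {e} → e ∈ uncovered → separators (proj₁ e) (proj₂ e) * (2 ^ w * 2 ^ w) ≡ 2 ^ m
      separations {A , B} e∈uncovered =
        let e∈V² , disjoint∧¬covered = ∈-filter⁻ (T? ∘ _) {xs = cartesianProduct verts verts} e∈uncovered
            A∈V , B∈V = ∈-cartesianProduct⁻ verts verts e∈V²
        in begin
        separators A B * (2 ^ w * 2 ^ w)     ≡⟨ cong (separators A B *_) (sym (^-distribˡ-+-* 2 w w)) ⟩
        separators A B * 2 ^ (w + w)         ≡⟨ cong (λ n → separators A B * 2 ^ n)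
                                                     (sym (cong₂ _+_ (∣vertex∣≡w A∈V) (∣vertex∣≡w B∈V))) ⟩
        separators A B * 2 ^ (∣ A ∣ + ∣ B ∣) ≡⟨ separators-count A B
                                                     (disjointᵇ⇒Empty (proj₁ (Equivalence.to T-∧ disjoint∧¬covered))) ⟩
        2 ^ m                                ∎

    uncovered-bound : length uncovered * p ≤ 2 ^ w * 2 * nV G * k
    uncovered-bound = *-cancelʳ-≤ _ _ (2 ^ m) {{m^n≢0 2 m}} (begin
      length uncovered * p * 2 ^ m     ≡⟨ l*p*M≡l*M*p (length uncovered) p (2 ^ m) ⟩
      length uncovered * 2 ^ m * p     ≡⟨ cong (_* p) (sym uncovered-separations) ⟩
      X * (2 ^ w * 2 ^ w) * p          ≡⟨ X*[t*t]*p≡t*t*[p*X] X (2 ^ w) p ⟩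
      2 ^ w * 2 ^ w * (p * X)          ≤⟨ *-monoʳ-≤ (2 ^ w * 2 ^ w) weighted-bound ⟩
      2 ^ w * 2 ^ w * (k * (ΣL + ΣR))  ≡⟨ t*t*[k*[a+b]]≡t*k*[a*t+b*t] (2 ^ w) k ΣL ΣR ⟩
      2 ^ w * k * (ΣL * 2 ^ w + ΣR * 2 ^ w)
        ≡⟨ cong (2 ^ w * k *_) (cong₂ _+_ (∑-length-filterᵇ-regular _⊆ᵇ_ supersets-count)
                                        (∑-length-filterᵇ-regular disjointᵇ disjoint-count)) ⟩
      2 ^ w * k * (nV G * 2 ^ m + nV G * 2 ^ m)
        ≡⟨ t*k*[N*M+N*M]≡t*2*N*k*M (2 ^ w) k (nV G) (2 ^ m) ⟩
      2 ^ w * 2 * nV G * k * 2 ^ m     ∎)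
      where
      open ≤-Reasoning
      X ΣL ΣR : ℕ
      X  = ∑[ U ∈ allSubsets m ] count (separatesᵇ U) uncovered
      ΣL = ∑[ U ∈ allSubsets m ] length (lower U)
      ΣR = ∑[ U ∈ allSubsets m ] length (upper U)
      weighted-bound : p * X ≤ k * (ΣL + ΣR)
      weighted-bound = begin
        p * X
          ≡⟨ sym (∑-*ˡ (allSubsets m) p _) ⟩
        ∑[ U ∈ allSubsets m ] (p * count (separatesᵇ U) uncovered)
          ≤⟨ ∑-mono (allSubsets m) separated-uncovered-bound ⟩
        ∑[ U ∈ allSubsets m ] (k * (length (lower U) + length (upper U)))
          ≡⟨ ∑-*ˡ (allSubsets m) k _ ⟩
        k * ∑[ U ∈ allSubsets m ] (length (lower U) + length (upper U))
          ≡⟨ cong (k *_) (∑-+ (allSubsets m) _ _) ⟩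
        k * (ΣL + ΣR) ∎
      l*p*M≡l*M*p : ∀ l p M → l * p * M ≡ l * M * p
      l*p*M≡l*M*p = solve-∀
      X*[t*t]*p≡t*t*[p*X] : ∀ X t p → X * (t * t) * p ≡ t * t * (p * X)
      X*[t*t]*p≡t*t*[p*X] = solve-∀
      t*t*[k*[a+b]]≡t*k*[a*t+b*t] : ∀ t k a b → t * t * (k * (a + b)) ≡ t * k * (a * t + b * t)
      t*t*[k*[a+b]]≡t*k*[a*t+b*t] = solve-∀
      t*k*[N*M+N*M]≡t*2*N*k*M : ∀ t k N M → t * k * (N * M + N * M) ≡ t * 2 * N * k * M
      t*k*[N*M+N*M]≡t*2*N*k*M = solve-∀

toℚᵘ-ℕtoℚ-* : ∀ k p d .(c : Coprime p (suc d)) → toℚᵘ (ℕtoℚ k *ℚ mkℚ (ℤ.+ p) d c) ≃ mkℚᵘ (ℤ.+ (k * p)) d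
toℚᵘ-ℕtoℚ-* k p d c rewrite normalize-coprime (coprime-sym (1-coprimeTo k)) =
  ℚᵘ.≃-trans (toℚᵘ-homo-* (mkℚ (ℤ.+ k) 0 (coprime-sym (1-coprimeTo k))) (mkℚ (ℤ.+ p) d c))
             (*≡* (cong₂ ℤ._*_ (sym (ℤ.pos-* k p)) (cong (λ n → ℤ.+ suc n) (sym (+-identityʳ d)))))

ℕtoℚ-*-≤ : ∀ k M p d .(c : Coprime p (suc d)) → k * p ≤ M * suc d → ℕtoℚ k *ℚ mkℚ (ℤ.+ p) d c ≤ℚ ℕtoℚ M
ℕtoℚ-*-≤ k M p d c kp≤Md rewrite normalize-coprime (coprime-sym (1-coprimeTo M)) =
  toℚᵘ-cancel-≤ (ℚᵘ.≤-respˡ-≃ (ℚᵘ.≃-sym (toℚᵘ-ℕtoℚ-* k p d c))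
    (*≤* (subst₂ ℤ._≤_ (sym (ℤ.*-identityʳ _)) (ℤ.pos-* M (suc d)) (ℤ.+≤+ kp≤Md))))

ℕtoℚ-≤-* : ∀ k M p d .(c : Coprime p (suc d)) → M * suc d ≤ k * p → ℕtoℚ M ≤ℚ ℕtoℚ k *ℚ mkℚ (ℤ.+ p) d c
ℕtoℚ-≤-* k M p d c Md≤kp rewrite normalize-coprime (coprime-sym (1-coprimeTo M)) =
  toℚᵘ-cancel-≤ (ℚᵘ.≤-respʳ-≃ (ℚᵘ.≃-sym (toℚᵘ-ℕtoℚ-* k p d c))
    (*≤* (subst₂ ℤ._≤_ (ℤ.pos-* M (suc d)) (sym (ℤ.*-identityʳ _)) (ℤ.+≤+ Md≤kp))))

theorem1p5 : (m w : ℕ) (G : InducedKneserSubgraph m w) (n : ℚ) → 0ℚ <ℚ n →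
    Σ (List (Subset m × Subset m)) λ Bad →
      (ℕtoℚ (length Bad) *ℚ n ≤ℚ ℕtoℚ ((2 ^ w) * (2 * w + 2) * (nV G * nV G)))
      × ((A B : Subset m) → A ∈ InducedKneserSubgraph.verts G → B ∈ InducedKneserSubgraph.verts G →
          Adj A B → (A , B) ∉ Bad → (B , A) ∉ Bad →
          ∃₂ λ (L R : List (Subset m)) → Biclique G L R × A ∈ L × B ∈ R
            × (ℕtoℚ (nV G) ≤ℚ ℕtoℚ (length L) *ℚ n)
            × (ℕtoℚ (nV G) ≤ℚ ℕtoℚ (length R) *ℚ n))
theorem1p5 m w G (mkℚ ℤ.-[1+ _ ] _ _) n>0 with () ← positive n>0
theorem1p5 m w G (mkℚ (ℤ.+ p) d c) _ =
  uncovered G k p , ℕtoℚ-*-≤ (length (uncovered G k p)) (2 ^ w * (2 * w + 2) * (N * N)) p d c bound ,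
  λ A B A∈V B∈V A~B AB∉uncovered _ →
    let L , R , biclique , A∈L , B∈R , k≤L , k≤R = edge-in-balanced-biclique G k p A∈V B∈V A~B AB∉uncovered
    in L , R , biclique , A∈L , B∈R , ℕtoℚ-≤-* (length L) N p d c k≤L , ℕtoℚ-≤-* (length R) N p d c k≤R
  where
  N k : ℕ
  N = nV G
  k = N * suc d
  bound : length (uncovered G k p) * p ≤ 2 ^ w * (2 * w + 2) * (N * N) * suc d
  bound = begin
    length (uncovered G k p) * p           ≤⟨ uncovered-bound G k p ⟩
    2 ^ w * 2 * N * (N * suc d)            ≡⟨ t*2*N*[N*q]≡t*2*[N*N]*q (2 ^ w) N (suc d) ⟩
    2 ^ w * 2 * (N * N) * suc d            ≤⟨ *-monoˡ-≤ (suc d) (*-monoˡ-≤ (N * N) (*-monoʳ-≤ (2 ^ w) 2≤2w+2)) ⟩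
    2 ^ w * (2 * w + 2) * (N * N) * suc d  ∎
    where
    open ≤-Reasoning
    t*2*N*[N*q]≡t*2*[N*N]*q : ∀ t N q → t * 2 * N * (N * q) ≡ t * 2 * (N * N) * q
    t*2*N*[N*q]≡t*2*[N*N]*q = solve-∀
    2≤2w+2 : 2 ≤ 2 * w + 2
    2≤2w+2 = m≤n+m 2 (2 * w)
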